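{- Let $p\ge 5$ be a prime and let $q_p(2)=\frac{2^{p-1}-1}{p}$. Then $$q_p(2)^2\equiv 2\sum_{\substack{1\le i<j\le p-1\\ i,\,j\ \text{even}}}\frac{1}{ij}\equiv 2\sum_{\substack{1\le i<j\le p-1\\ i,\,j\ \text{odd}}}\frac{1}{ij}\pmod{p}.$$
   Context: Congruences modulo a prime power $p^e$ are extended to rational numbers whose denominators are not divisible by $p$: for such fractions, $m/n\equiv r/s \pmod{p^e}$ means $ms\equiv nr\pmod{p^e}$. The quantity $q_p(2)$ is the Fermat quotient of $p$ to base $2$, an integer. -}

module Defs where

open import Data.Nat as ℕ using (ℕ; zero; suc; _∸_; _^_; _<ᵇ_; _≡ᵇ_)
open import Data.Nat.DivMod using (_/_; _%_)
open import Data.Bool using (Bool; true; false; if_then_else_; _∧_)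
open import Data.List using (List; foldr; map; concatMap)
open import Data.List.Base using (upTo)
open import Data.Integer as ℤ using (ℤ; +_)
open import Data.Integer.Divisibility using (_∣_)
open import Data.Rational as ℚ using (ℚ; ↥_; ↧_; 0ℚ)

_≡ℚ_[mod_] : ℚ → ℚ → ℕ → Set
x ≡ℚ y [mod m ] = (+ m) ∣ ((↥ x ℤ.* ↧ y) ℤ.- (↥ y ℤ.* ↧ x))

-- Fermat quotient q_p(2) = (2^(p-1) - 1)/p (exact division when p is an odd prime).
fermatQuotient2 : ℕ → ℕ
fermatQuotient2 zero    = 0
fermatQuotient2 (suc n) = ((2 ^ n) ∸ 1) / suc n

-- 1/n as a rational (with 1/0 := 0, never used below since i, j ≥ 1).
inv : ℕ → ℚ
inv zero    = 0ℚ
inv (suc n) = (+ 1) ℚ./ suc n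

isEven : ℕ → Bool
isEven n = (n % 2) ≡ᵇ 0

sumℚ : List ℚ → ℚ
sumℚ = foldr ℚ._+_ 0ℚ

range1 : ℕ → List ℕ
range1 p = map suc (upTo (p ∸ 1))

pairSum : Bool → ℕ → ℚ
pairSum b p = sumℚ (concatMap (λ i → concatMap (λ j →
    if (i <ᵇ j) ∧ par i ∧ par j then inv (i ℕ.* j) Data.List.∷ Data.List.[] else Data.List.[])
    (range1 p)) (range1 p))
  where
    par : ℕ → Bool
    par n = if b then isEven n else (if isEven n then false else true)

module Submission where

open import Defs
open import Data.Nat using (ℕ; _≤_; _^_)
open import Data.Nat.Primality using (Prime)
open import Data.Product using (_×_)
open import Data.Bool using (true; false)
open import Data.Integer using (+_)
open import Data.Rational using (_/_; _*_)

open import Level using (0ℓ)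
open import Data.Empty using (⊥-elim)
open import Data.Maybe.Base using (Maybe; just; nothing)
open import Data.Product.Base using (_,_; ∃-syntax)
open import Data.Sum using (_⊎_; inj₁; inj₂; [_,_]′)
open import Data.Bool.Base using (Bool; if_then_else_; _∧_)
open import Data.List.Base using (List; []; _∷_; _++_; map; concatMap; applyUpTo)
open import Relation.Nullary using (¬_; yes; no)
open import Relation.Binary.PropositionalEquality
open import Relation.Binary.Bundles using (Setoid)
import Relation.Binary.Reasoning.Setoid as SetoidReasoning

open import Data.Nat.Base as ℕ using (zero; suc; _<_; _∸_; _<ᵇ_; _≡ᵇ_; s≤s; z≤n; nonTrivial⇒≢1)
import Data.Nat.Properties as ℕ
open import Data.Nat.DivMod using (_%_; m/n*n≡m; [m+kn]%n≡m%n)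
open import Data.Nat.Divisibility using (_∣_; divides; _∣0; ∣⇒≤; ∣1⇒≡1)
open import Data.Nat.Primality
  using (euclidsLemma; prime⇒nonTrivial; prime⇒¬composite; composite)
open import Data.Nat.Combinatorics
  using (_C_; nCk+nC[k+1]≡[n+1]C[k+1]; nC1≡n; nCn≡1; k>n⇒nCk≡0)
import Data.Nat.Coprimality as Coprime
open import Data.Integer.Base as ℤ using (ℤ; ∣_∣)
import Data.Integer.Properties as ℤ
open import Data.Integer.Divisibility using () renaming (_∣_ to _∣ℤ_)
open import Data.Rational.Base using (ℚ; mkℚ; _+_; -_; _-_; 0ℚ; 1ℚ; ↥_; ↧_)
open import Data.Rational.Properties as ℚ
  using ( toℚᵘ-injective; toℚᵘ-cong; toℚᵘ-fromℚᵘ; normalize-coprime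
        ; toℚᵘ-homo-+; toℚᵘ-homo-*; toℚᵘ-homo‿- )
open import Data.Rational.Unnormalised.Base using (mkℚᵘ; *≡*)
import Data.Rational.Unnormalised.Properties as ℚᵘ

open import Tactic.RingSolver using (solve-∀)
open import Tactic.RingSolver.Core.AlmostCommutativeRing
  using (AlmostCommutativeRing; fromCommutativeRing)
import Data.Integer.Tactic.RingSolver as ℤ-Solver
import Data.Nat.Tactic.RingSolver as ℕ-Solver

-- Write p = 2h + 1, A and O for the sums of 1/k over the even resp. odd k in
-- [1, p − 1], and E, O₂ for the corresponding sums of 1/k².  Four facts give the result.
--  * 2 ∑_{i<j} w i · w j = (∑ w)² − ∑ w² for any weights (square-of-sum); with w the
--    reciprocals of one parity, twice the even (odd) pair sum is exactly A² − E (O² − O₂).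
--  * The reflection k ↦ p − k swaps parities and sends 1/k to −1/k mod p: O ≡ −A, O₂ ≡ E.
--  * E ≡ 0: E is a quarter of S = ∑_{k ≤ h} 1/k², while reflecting the upper half of
--    [1, p − 1] onto the lower one gives O₂ + E ≡ 2S; hence 6E ≡ 0, and p ∤ 6.
--  * By the binomial theorem with C(p, k+1) = p·C(p−1, k)/(k+1) and C(p−1, k) ≡ (−1)^k,
--    2q = ∑_{k<p−1} C(p−1, k)/(k+1) ≡ O − A ≡ −2A, hence q ≡ −A.
-- Then q² ≡ A² ≡ A² − E, and A² − E ≡ O² − O₂.
--
-- Congruences between rationals are handled inside ℚ: x ≈ y means x − y = p·z with z
-- p-integral (module Congruence, for any prime p), which implies the cross-multiplied
-- congruence of the statement.

ℚ-ring : AlmostCommutativeRing 0ℓ 0ℓ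
ℚ-ring = fromCommutativeRing ℚ.+-*-commutativeRing isZero
  where
    isZero : (x : ℚ) → Maybe (0ℚ ≡ x)
    isZero x with 0ℚ ℚ.≟ x
    ... | yes 0≡x = just 0≡x
    ... | no _    = nothing

fromℤ : ℤ → ℚ
fromℤ z = mkℚ z 0 (Coprime.sym (Coprime.1-coprimeTo _))

fromℕ : ℕ → ℚ
fromℕ n = fromℤ (+ n)

fromℤ-+ : ∀ a b → fromℤ (a ℤ.+ b) ≡ fromℤ a + fromℤ b
fromℤ-+ a b = toℚᵘ-injective
  (ℚᵘ.≃-trans (*≡* (eq a b)) (ℚᵘ.≃-sym (toℚᵘ-homo-+ (fromℤ a) (fromℤ b))))
  where
    eq : ∀ a b → (a ℤ.+ b) ℤ.* + 1 ≡ (a ℤ.* + 1 ℤ.+ b ℤ.* + 1) ℤ.* + 1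
    eq = ℤ-Solver.solve-∀

fromℤ-* : ∀ a b → fromℤ (a ℤ.* b) ≡ fromℤ a * fromℤ b
fromℤ-* a b = toℚᵘ-injective (ℚᵘ.≃-sym (toℚᵘ-homo-* (fromℤ a) (fromℤ b)))

fromℤ-neg : ∀ a → fromℤ (ℤ.- a) ≡ - fromℤ a
fromℤ-neg a = toℚᵘ-injective (ℚᵘ.≃-sym (toℚᵘ-homo‿- (fromℤ a)))

fromℤ-injective : ∀ {a b} → fromℤ a ≡ fromℤ b → a ≡ b
fromℤ-injective {a} {b} eq with toℚᵘ-cong eq
... | *≡* a*1≡b*1 = trans (sym (ℤ.*-identityʳ a)) (trans a*1≡b*1 (ℤ.*-identityʳ b))

fromℕ-+ : ∀ m n → fromℕ (m ℕ.+ n) ≡ fromℕ m + fromℕ n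
fromℕ-+ m n = trans (cong fromℤ (ℤ.pos-+ m n)) (fromℤ-+ (+ m) (+ n))

fromℕ-* : ∀ m n → fromℕ (m ℕ.* n) ≡ fromℕ m * fromℕ n
fromℕ-* m n = trans (cong fromℤ (ℤ.pos-* m n)) (fromℤ-* (+ m) (+ n))

/1≡fromℕ : ∀ n → (+ n) / 1 ≡ fromℕ n
/1≡fromℕ n = normalize-coprime _

clear-denominator : ∀ x → x * fromℤ (↧ x) ≡ fromℤ (↥ x)
clear-denominator x@(mkℚ n d _) = toℚᵘ-injective
  (ℚᵘ.≃-trans (toℚᵘ-homo-* x (fromℤ (↧ x))) (*≡* (eq n (+ suc d))))
  where
    eq : ∀ n m → (n ℤ.* m) ℤ.* + 1 ≡ n ℤ.* (m ℤ.* + 1)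
    eq = ℤ-Solver.solve-∀

inv-cancel : ∀ n → inv (suc n) * fromℕ (suc n) ≡ 1ℚ
inv-cancel n = toℚᵘ-injective
  (ℚᵘ.≃-trans (toℚᵘ-homo-* (inv (suc n)) (fromℕ (suc n)))
    (ℚᵘ.≃-trans (ℚᵘ.*-congʳ (toℚᵘ-fromℚᵘ (mkℚᵘ (+ 1) n))) (*≡* (eq (+ suc n)))))
  where
    eq : ∀ m → (+ 1 ℤ.* m) ℤ.* + 1 ≡ + 1 ℤ.* (m ℤ.* + 1)
    eq = ℤ-Solver.solve-∀

inverse-unique : ∀ x y m → x * m ≡ 1ℚ → y * m ≡ 1ℚ → x ≡ y
inverse-unique x y m xm≡1 ym≡1 = begin
  x            ≡⟨ ℚ.*-identityʳ x ⟨
  x * 1ℚ       ≡⟨ cong (x *_) ym≡1 ⟨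
  x * (y * m)  ≡⟨ swap x y m ⟩
  y * (x * m)  ≡⟨ cong (y *_) xm≡1 ⟩
  y * 1ℚ       ≡⟨ ℚ.*-identityʳ y ⟩
  y            ∎
  where
    open ≡-Reasoning
    swap : ∀ x y m → x * (y * m) ≡ y * (x * m)
    swap = solve-∀ ℚ-ring

inv-* : ∀ m n → inv (suc m ℕ.* suc n) ≡ inv (suc m) * inv (suc n)
inv-* m n = inverse-unique _ _ (fromℕ (suc m ℕ.* suc n)) (inv-cancel (n ℕ.+ m ℕ.* suc n)) (begin
  inv (suc m) * inv (suc n) * fromℕ (suc m ℕ.* suc n)
    ≡⟨ cong (inv (suc m) * inv (suc n) *_) (fromℕ-* (suc m) (suc n)) ⟩
  inv (suc m) * inv (suc n) * (fromℕ (suc m) * fromℕ (suc n))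
    ≡⟨ interchange (inv (suc m)) (inv (suc n)) (fromℕ (suc m)) (fromℕ (suc n)) ⟩
  (inv (suc m) * fromℕ (suc m)) * (inv (suc n) * fromℕ (suc n))
    ≡⟨ cong₂ _*_ (inv-cancel m) (inv-cancel n) ⟩
  1ℚ ∎)
  where
    open ≡-Reasoning
    interchange : ∀ x y a b → (x * y) * (a * b) ≡ (x * a) * (y * b)
    interchange = solve-∀ ℚ-ring

fromℕ-cancelˡ : ∀ m {x y} → fromℕ (suc m) * x ≡ fromℕ (suc m) * y → x ≡ y
fromℕ-cancelˡ m {x} {y} mx≡my =
  trans (unscale x) (trans (cong (inv (suc m) *_) mx≡my) (sym (unscale y)))
  where
    open ≡-Reasoning
    unscale : ∀ z → z ≡ inv (suc m) * (fromℕ (suc m) * z)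
    unscale z = begin
      z                                       ≡⟨ ℚ.*-identityˡ z ⟨
      1ℚ * z                                  ≡⟨ cong (_* z) (inv-cancel m) ⟨
      (inv (suc m) * fromℕ (suc m)) * z       ≡⟨ ℚ.*-assoc (inv (suc m)) (fromℕ (suc m)) z ⟩
      inv (suc m) * (fromℕ (suc m) * z)       ∎

∑ : ℕ → (ℕ → ℚ) → ℚ
∑ zero    f = 0ℚ
∑ (suc n) f = f 0 + ∑ n (λ k → f (suc k))

∑-snoc : ∀ n f → ∑ (suc n) f ≡ ∑ n f + f n
∑-snoc zero    f = trans (ℚ.+-identityʳ (f 0)) (sym (ℚ.+-identityˡ (f 0)))
∑-snoc (suc n) f = trans (cong (λ t → f 0 + t) (∑-snoc n (λ k → f (suc k))))
                         (sym (ℚ.+-assoc (f 0) _ _))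

∑-cong : ∀ n {f g} → (∀ k → k < n → f k ≡ g k) → ∑ n f ≡ ∑ n g
∑-cong zero    f≡g = refl
∑-cong (suc n) f≡g = cong₂ _+_ (f≡g 0 (s≤s z≤n)) (∑-cong n (λ k k<n → f≡g (suc k) (s≤s k<n)))

∑-+ : ∀ n f g → ∑ n (λ k → f k + g k) ≡ ∑ n f + ∑ n g
∑-+ zero    f g = refl
∑-+ (suc n) f g = trans (cong (λ t → f 0 + g 0 + t) (∑-+ n _ _)) (shuffle (f 0) (g 0) _ _)
  where
    shuffle : ∀ a b c d → (a + b) + (c + d) ≡ (a + c) + (b + d)
    shuffle = solve-∀ ℚ-ring

∑-*ʳ : ∀ n f c → ∑ n (λ k → f k * c) ≡ ∑ n f * c
∑-*ʳ zero    f c = sym (ℚ.*-zeroˡ c)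
∑-*ʳ (suc n) f c = trans (cong (λ t → f 0 * c + t) (∑-*ʳ n _ c)) (sym (ℚ.*-distribʳ-+ c (f 0) _))

∑-*ˡ : ∀ n c f → ∑ n (λ k → c * f k) ≡ c * ∑ n f
∑-*ˡ zero    c f = sym (ℚ.*-zeroʳ c)
∑-*ˡ (suc n) c f = trans (cong (λ t → c * f 0 + t) (∑-*ˡ n c _)) (sym (ℚ.*-distribˡ-+ c (f 0) _))

∑-neg : ∀ n f → ∑ n (λ k → - f k) ≡ - ∑ n f
∑-neg zero    f = refl
∑-neg (suc n) f = trans (cong (λ t → - f 0 + t) (∑-neg n _)) (sym (ℚ.neg-distrib-+ (f 0) _))

∑-zero : ∀ n → ∑ n (λ _ → 0ℚ) ≡ 0ℚ
∑-zero zero    = refl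
∑-zero (suc n) = trans (ℚ.+-identityˡ _) (∑-zero n)

∑-split : ∀ a b f → ∑ (a ℕ.+ b) f ≡ ∑ a f + ∑ b (λ k → f (a ℕ.+ k))
∑-split zero    b f = sym (ℚ.+-identityˡ _)
∑-split (suc a) b f = trans (cong (λ t → f 0 + t) (∑-split a b (λ k → f (suc k))))
                            (sym (ℚ.+-assoc (f 0) _ _))

∑-pairs : ∀ n f → ∑ (n ℕ.+ n) f ≡ ∑ n (λ m → f (m ℕ.+ m) + f (suc (m ℕ.+ m)))
∑-pairs zero    f = refl
∑-pairs (suc n) f = begin
  f 0 + ∑ (n ℕ.+ suc n) (λ k → f (suc k))
    ≡⟨ cong (λ t → f 0 + ∑ t (λ k → f (suc k))) (ℕ.+-suc n n) ⟩
  f 0 + (f 1 + ∑ (n ℕ.+ n) (λ k → f (2 ℕ.+ k)))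
    ≡⟨ cong (λ t → f 0 + (f 1 + t)) (∑-pairs n (λ k → f (2 ℕ.+ k))) ⟩
  f 0 + (f 1 + ∑ n (λ m → f (2 ℕ.+ (m ℕ.+ m)) + f (3 ℕ.+ (m ℕ.+ m))))
    ≡⟨ ℚ.+-assoc (f 0) (f 1) _ ⟨
  (f 0 + f 1) + ∑ n (λ m → f (2 ℕ.+ (m ℕ.+ m)) + f (3 ℕ.+ (m ℕ.+ m)))
    ≡⟨ cong (λ t → (f 0 + f 1) + t) (∑-cong n (λ m _ → cong (λ t → f (suc t) + f (suc (suc t)))
                                                      (sym (ℕ.+-suc m m)))) ⟩
  (f 0 + f 1) + ∑ n (λ m → f (suc m ℕ.+ suc m) + f (suc (suc m ℕ.+ suc m))) ∎
  where open ≡-Reasoning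

∑-reverse : ∀ n f → ∑ n f ≡ ∑ n (λ k → f (n ∸ suc k))
∑-reverse zero    f = refl
∑-reverse (suc n) f = begin
  ∑ (suc n) f                       ≡⟨ ∑-snoc n f ⟩
  ∑ n f + f n                       ≡⟨ cong (_+ f n) (∑-reverse n f) ⟩
  ∑ n (λ k → f (n ∸ suc k)) + f n   ≡⟨ ℚ.+-comm _ (f n) ⟩
  f n + ∑ n (λ k → f (n ∸ suc k))   ∎
  where open ≡-Reasoning

-- The sum of the products g a · g c over all pairs a < c < n, written as a
-- double sum with an indicator (the shape in which pairSum is defined).
pairProducts : ℕ → (ℕ → ℚ) → ℚ
pairProducts n g = ∑ n (λ a → ∑ n (λ c → if a <ᵇ c then g a * g c else 0ℚ))

<ᵇ-true : ∀ {a c} → a < c → (a <ᵇ c) ≡ true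
<ᵇ-true {zero}  {suc c} _         = refl
<ᵇ-true {suc a} {suc c} (s≤s a<c) = <ᵇ-true a<c

<ᵇ-false : ∀ {a c} → c ≤ a → (a <ᵇ c) ≡ false
<ᵇ-false {a}     {zero}  _         = refl
<ᵇ-false {suc a} {suc c} (s≤s c≤a) = <ᵇ-false c≤a

pairProducts-step : ∀ n g → pairProducts (suc n) g ≡ pairProducts n g + ∑ n g * g n
pairProducts-step n g = begin
  pairProducts (suc n) g
    ≡⟨ ∑-cong (suc n) (λ a _ → ∑-snoc n (term a)) ⟩
  ∑ (suc n) (λ a → row a + term a n)
    ≡⟨ ∑-+ (suc n) row (λ a → term a n) ⟩
  ∑ (suc n) row + ∑ (suc n) (λ a → term a n)
    ≡⟨ cong₂ _+_ (∑-snoc n row) (∑-snoc n (λ a → term a n)) ⟩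
  (pairProducts n g + row n) + (∑ n (λ a → term a n) + term n n)
    ≡⟨ cong₂ (λ r t → (pairProducts n g + r) + (∑ n (λ a → term a n) + t))
             last-row-vanishes diagonal-vanishes ⟩
  (pairProducts n g + 0ℚ) + (∑ n (λ a → term a n) + 0ℚ)
    ≡⟨ cong₂ _+_ (ℚ.+-identityʳ (pairProducts n g)) (ℚ.+-identityʳ (∑ n (λ a → term a n))) ⟩
  pairProducts n g + ∑ n (λ a → term a n)
    ≡⟨ cong (λ t → pairProducts n g + t) (trans (∑-cong n last-column) (∑-*ʳ n g (g n))) ⟩
  pairProducts n g + ∑ n g * g n ∎
  where
    open ≡-Reasoning
    term : ℕ → ℕ → ℚ
    term a c = if a <ᵇ c then g a * g c else 0ℚ
    row : ℕ → ℚ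
    row a = ∑ n (term a)
    last-row-vanishes : row n ≡ 0ℚ
    last-row-vanishes = trans
      (∑-cong n (λ c c<n → cong (λ b → if b then g n * g c else 0ℚ) (<ᵇ-false (ℕ.<⇒≤ c<n))))
      (∑-zero n)
    diagonal-vanishes : term n n ≡ 0ℚ
    diagonal-vanishes = cong (λ b → if b then g n * g n else 0ℚ) (<ᵇ-false {n} ℕ.≤-refl)
    last-column : ∀ a → a < n → term a n ≡ g a * g n
    last-column a a<n = cong (λ b → if b then g a * g n else 0ℚ) (<ᵇ-true a<n)

square-of-sum : ∀ n g →
  fromℕ 2 * pairProducts n g ≡ ∑ n g * ∑ n g - ∑ n (λ k → g k * g k)
square-of-sum zero    g = refl
square-of-sum (suc n) g = begin
  fromℕ 2 * pairProducts (suc n) g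
    ≡⟨ cong (fromℕ 2 *_) (pairProducts-step n g) ⟩
  fromℕ 2 * (pairProducts n g + S * g n)
    ≡⟨ ℚ.*-distribˡ-+ (fromℕ 2) (pairProducts n g) (S * g n) ⟩
  fromℕ 2 * pairProducts n g + fromℕ 2 * (S * g n)
    ≡⟨ cong (λ t → t + fromℕ 2 * (S * g n)) (square-of-sum n g) ⟩
  (S * S - Q) + fromℕ 2 * (S * g n)
    ≡⟨ expand S (g n) Q ⟩
  (S + g n) * (S + g n) - (Q + g n * g n)
    ≡⟨ cong₂ (λ s q → s * s - q) (∑-snoc n g) (∑-snoc n (λ k → g k * g k)) ⟨
  ∑ (suc n) g * ∑ (suc n) g - ∑ (suc n) (λ k → g k * g k) ∎
  where
    open ≡-Reasoning
    S Q : ℚ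
    S = ∑ n g
    Q = ∑ n (λ k → g k * g k)
    expand : ∀ s x q → (s * s - q) + (1ℚ + 1ℚ) * (s * x) ≡ (s + x) * (s + x) - (q + x * x)
    expand = solve-∀ ℚ-ring

absorption : ∀ n k → suc k ℕ.* (suc n C suc k) ≡ suc n ℕ.* (n C k)
absorption zero    zero    = refl
absorption zero    (suc k) =
  trans (cong (suc (suc k) ℕ.*_) (k>n⇒nCk≡0 {1} {suc (suc k)} (s≤s (s≤s z≤n))))
        (ℕ.*-zeroʳ (suc (suc k)))
absorption (suc n) zero    =
  trans (ℕ.*-identityˡ _) (trans (nC1≡n (suc (suc n))) (sym (ℕ.*-identityʳ _)))
absorption (suc n) (suc k) = begin
  (2 ℕ.+ k) ℕ.* (suc (suc n) C (2 ℕ.+ k))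
    ≡⟨ cong ((2 ℕ.+ k) ℕ.*_) (pascal (suc n) (suc k)) ⟨
  (2 ℕ.+ k) ℕ.* (suc n C suc k ℕ.+ suc n C (2 ℕ.+ k))
    ≡⟨ regroup k (suc n C suc k) (suc n C (2 ℕ.+ k)) ⟩
  suc n C suc k ℕ.+ suc k ℕ.* (suc n C suc k) ℕ.+ (2 ℕ.+ k) ℕ.* (suc n C (2 ℕ.+ k))
    ≡⟨ cong₂ (λ u v → suc n C suc k ℕ.+ u ℕ.+ v) (absorption n k) (absorption n (suc k)) ⟩
  suc n C suc k ℕ.+ suc n ℕ.* (n C k) ℕ.+ suc n ℕ.* (n C suc k)
    ≡⟨ factor n (suc n C suc k) (n C k) (n C suc k) ⟩
  suc n C suc k ℕ.+ suc n ℕ.* (n C k ℕ.+ n C suc k)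
    ≡⟨ cong (λ t → suc n C suc k ℕ.+ suc n ℕ.* t) (pascal n k) ⟩
  suc n C suc k ℕ.+ suc n ℕ.* (suc n C suc k)
    ≡⟨⟩
  (2 ℕ.+ n) ℕ.* (suc n C suc k) ∎
  where
    open ≡-Reasoning
    pascal : ∀ n k → n C k ℕ.+ n C suc k ≡ suc n C suc k
    pascal = nCk+nC[k+1]≡[n+1]C[k+1]
    regroup : ∀ k x y → (2 ℕ.+ k) ℕ.* (x ℕ.+ y) ≡ x ℕ.+ (1 ℕ.+ k) ℕ.* x ℕ.+ (2 ℕ.+ k) ℕ.* y
    regroup = ℕ-Solver.solve-∀
    factor : ∀ n c x y → c ℕ.+ suc n ℕ.* x ℕ.+ suc n ℕ.* y ≡ c ℕ.+ suc n ℕ.* (x ℕ.+ y)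
    factor = ℕ-Solver.solve-∀

binomial-sum : ∀ n → ∑ (suc n) (λ k → fromℕ (n C k)) ≡ fromℕ (2 ^ n)
binomial-sum zero    = refl
binomial-sum (suc n) = begin
  1ℚ + ∑ (suc n) (λ k → fromℕ (suc n C suc k))
    ≡⟨ cong (λ t → 1ℚ + t) (∑-cong (suc n) (λ k _ → pascal k)) ⟩
  1ℚ + ∑ (suc n) (λ k → fromℕ (n C k) + fromℕ (n C suc k))
    ≡⟨ cong (λ t → 1ℚ + t) (∑-+ (suc n) (λ k → fromℕ (n C k)) (λ k → fromℕ (n C suc k))) ⟩
  1ℚ + (S + ∑ (suc n) (λ k → fromℕ (n C suc k)))
    ≡⟨ left-comm 1ℚ S _ ⟩
  S + ∑ (suc (suc n)) (λ k → fromℕ (n C k))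
    ≡⟨ cong (λ t → S + t) (∑-snoc (suc n) (λ k → fromℕ (n C k))) ⟩
  S + (S + fromℕ (n C suc n))
    ≡⟨ cong (λ t → S + (S + fromℕ t)) (k>n⇒nCk≡0 (ℕ.n<1+n n)) ⟩
  S + (S + 0ℚ)
    ≡⟨ cong (λ t → S + t) (ℚ.+-identityʳ S) ⟩
  S + S
    ≡⟨ cong₂ _+_ (binomial-sum n) (binomial-sum n) ⟩
  fromℕ (2 ^ n) + fromℕ (2 ^ n)
    ≡⟨ fromℕ-+ (2 ^ n) (2 ^ n) ⟨
  fromℕ (2 ^ n ℕ.+ 2 ^ n)
    ≡⟨ cong (λ t → fromℕ (2 ^ n ℕ.+ t)) (ℕ.+-identityʳ (2 ^ n)) ⟨
  fromℕ (2 ^ suc n) ∎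
  where
    open ≡-Reasoning
    S : ℚ
    S = ∑ (suc n) (λ k → fromℕ (n C k))
    pascal : ∀ k → fromℕ (suc n C suc k) ≡ fromℕ (n C k) + fromℕ (n C suc k)
    pascal k = trans (cong fromℕ (sym (nCk+nC[k+1]≡[n+1]C[k+1] n k))) (fromℕ-+ (n C k) (n C suc k))
    left-comm : ∀ a b c → a + (b + c) ≡ b + (a + c)
    left-comm = solve-∀ ℚ-ring

binomial-absorbed : ∀ n k →
  fromℕ (suc n C suc k) ≡ fromℕ (suc n) * (fromℕ (n C k) * inv (suc k))
binomial-absorbed n k = begin
  fromℕ (suc n C suc k)
    ≡⟨ ℚ.*-identityˡ _ ⟨
  1ℚ * fromℕ (suc n C suc k)
    ≡⟨ cong (_* fromℕ (suc n C suc k)) (inv-cancel k) ⟨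
  (inv (suc k) * fromℕ (suc k)) * fromℕ (suc n C suc k)
    ≡⟨ ℚ.*-assoc (inv (suc k)) _ _ ⟩
  inv (suc k) * (fromℕ (suc k) * fromℕ (suc n C suc k))
    ≡⟨ cong (inv (suc k) *_) (fromℕ-* (suc k) (suc n C suc k)) ⟨
  inv (suc k) * fromℕ (suc k ℕ.* (suc n C suc k))
    ≡⟨ cong (λ t → inv (suc k) * fromℕ t) (absorption n k) ⟩
  inv (suc k) * fromℕ (suc n ℕ.* (n C k))
    ≡⟨ cong (inv (suc k) *_) (fromℕ-* (suc n) (n C k)) ⟩
  inv (suc k) * (fromℕ (suc n) * fromℕ (n C k))
    ≡⟨ rotate (inv (suc k)) (fromℕ (suc n)) (fromℕ (n C k)) ⟩
  fromℕ (suc n) * (fromℕ (n C k) * inv (suc k)) ∎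
  where
    open ≡-Reasoning
    rotate : ∀ i m c → i * (m * c) ≡ m * (c * i)
    rotate = solve-∀ ℚ-ring

-- Hence  2^(n+1) = 2 + (n+1) · ∑_{k<n} C(n, k)/(k+1):  the binomial expansion of
-- 2^(n+1) with the two outer terms split off and the inner ones absorbed.
power-of-two-expansion : ∀ n →
  fromℕ (2 ^ suc n) ≡ 1ℚ + (fromℕ (suc n) * ∑ n (λ k → fromℕ (n C k) * inv (suc k)) + 1ℚ)
power-of-two-expansion n = begin
  fromℕ (2 ^ suc n)
    ≡⟨ binomial-sum (suc n) ⟨
  1ℚ + ∑ (suc n) (λ k → fromℕ (suc n C suc k))
    ≡⟨ cong (λ t → 1ℚ + t) (∑-snoc n (λ k → fromℕ (suc n C suc k))) ⟩
  1ℚ + (∑ n (λ k → fromℕ (suc n C suc k)) + fromℕ (suc n C suc n))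
    ≡⟨ cong₂ (λ s c → 1ℚ + (s + fromℕ c))
             (∑-cong n (λ k _ → binomial-absorbed n k)) (nCn≡1 (suc n)) ⟩
  1ℚ + (∑ n (λ k → fromℕ (suc n) * (fromℕ (n C k) * inv (suc k))) + 1ℚ)
    ≡⟨ cong (λ s → 1ℚ + (s + 1ℚ)) (∑-*ˡ n (fromℕ (suc n)) _) ⟩
  1ℚ + (fromℕ (suc n) * ∑ n (λ k → fromℕ (n C k) * inv (suc k)) + 1ℚ) ∎
  where open ≡-Reasoning

-- pairSum b p as a sum of pair products: the list comprehension of Defs is a
-- double sum over 1 ≤ i, j ≤ p − 1 whose summand factors as w i · w j for i < j,
-- where w i = 1/i when i has parity b and 0 otherwise.
hasParity : Bool → ℕ → Bool
hasParity b n = if b then isEven n else (if isEven n then false else true)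

parityPart : Bool → ℕ → ℚ
parityPart b i = if hasParity b i then inv i else 0ℚ

sumℚ-++ : ∀ xs ys → sumℚ (xs ++ ys) ≡ sumℚ xs + sumℚ ys
sumℚ-++ []       ys = sym (ℚ.+-identityˡ _)
sumℚ-++ (x ∷ xs) ys = trans (cong (λ t → x + t) (sumℚ-++ xs ys)) (sym (ℚ.+-assoc x _ _))

sumℚ-concatMap : ∀ {A : Set} (F : A → List ℚ) xs →
  sumℚ (concatMap F xs) ≡ sumℚ (map (λ x → sumℚ (F x)) xs)
sumℚ-concatMap F []       = refl
sumℚ-concatMap F (x ∷ xs) =
  trans (sumℚ-++ (F x) (concatMap F xs)) (cong (λ t → sumℚ (F x) + t) (sumℚ-concatMap F xs))

sumℚ-range : ∀ (f : ℕ → ℚ) g n → sumℚ (map f (map suc (applyUpTo g n))) ≡ ∑ n (λ k → f (suc (g k)))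
sumℚ-range f g zero    = refl
sumℚ-range f g (suc n) = cong (λ t → f (suc (g 0)) + t) (sumℚ-range f (λ k → g (suc k)) n)

sumℚ-singleton : ∀ (c : Bool) x → sumℚ (if c then x ∷ [] else []) ≡ (if c then x else 0ℚ)
sumℚ-singleton true  x = ℚ.+-identityʳ x
sumℚ-singleton false x = refl

summand : Bool → ℕ → ℕ → ℚ
summand b i j = if (i <ᵇ j) ∧ hasParity b i ∧ hasParity b j then inv (i ℕ.* j) else 0ℚ

summand-factors : ∀ b a c →
  summand b (suc a) (suc c) ≡ (if a <ᵇ c then parityPart b (suc a) * parityPart b (suc c) else 0ℚ)
summand-factors b a c with a <ᵇ c
... | false = refl
... | true  = factors (hasParity b (suc a)) (hasParity b (suc c))
  where
    factors : ∀ u v → (if u ∧ v then inv (suc a ℕ.* suc c) else 0ℚ)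
                      ≡ (if u then inv (suc a) else 0ℚ) * (if v then inv (suc c) else 0ℚ)
    factors true  true  = inv-* a c
    factors true  false = sym (ℚ.*-zeroʳ (inv (suc a)))
    factors false v     = sym (ℚ.*-zeroˡ (if v then inv (suc c) else 0ℚ))

pairSum-as-pairProducts : ∀ b n → pairSum b (suc n) ≡ pairProducts n (λ k → parityPart b (suc k))
pairSum-as-pairProducts b n = begin
  pairSum b (suc n)
    ≡⟨ sumℚ-concatMap _ (range1 (suc n)) ⟩
  sumℚ (map (λ i → sumℚ (concatMap (row i) (range1 (suc n)))) (range1 (suc n)))
    ≡⟨ sumℚ-range _ (λ k → k) n ⟩
  ∑ n (λ a → sumℚ (concatMap (row (suc a)) (range1 (suc n))))
    ≡⟨ ∑-cong n (λ a _ → inner a) ⟩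
  pairProducts n (λ k → parityPart b (suc k)) ∎
  where
    open ≡-Reasoning
    row : ℕ → ℕ → List ℚ
    row i j = if (i <ᵇ j) ∧ hasParity b i ∧ hasParity b j then inv (i ℕ.* j) ∷ [] else []
    inner : ∀ a → sumℚ (concatMap (row (suc a)) (range1 (suc n)))
                  ≡ ∑ n (λ c → if a <ᵇ c then parityPart b (suc a) * parityPart b (suc c) else 0ℚ)
    inner a = begin
      sumℚ (concatMap (row (suc a)) (range1 (suc n)))
        ≡⟨ sumℚ-concatMap (row (suc a)) (range1 (suc n)) ⟩
      sumℚ (map (λ j → sumℚ (row (suc a) j)) (range1 (suc n)))
        ≡⟨ sumℚ-range _ (λ k → k) n ⟩
      ∑ n (λ c → sumℚ (row (suc a) (suc c)))
        ≡⟨ ∑-cong n (λ c _ → trans (sumℚ-singleton _ (inv (suc a ℕ.* suc c))) (summand-factors b a c)) ⟩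
      ∑ n (λ c → if a <ᵇ c then parityPart b (suc a) * parityPart b (suc c) else 0ℚ) ∎

isEven-odd : ∀ m → isEven (suc (m ℕ.+ m)) ≡ false
isEven-odd m = cong (λ r → r ≡ᵇ 0) (trans (cong (_% 2) (odd-form m)) ([m+kn]%n≡m%n 1 m 2))
  where
    odd-form : ∀ m → suc (m ℕ.+ m) ≡ 1 ℕ.+ m ℕ.* 2
    odd-form = ℕ-Solver.solve-∀

isEven-even : ∀ m → isEven (2 ℕ.+ (m ℕ.+ m)) ≡ true
isEven-even m = cong (λ r → r ≡ᵇ 0) (trans (cong (_% 2) (even-form m)) ([m+kn]%n≡m%n 0 (suc m) 2))
  where
    even-form : ∀ m → 2 ℕ.+ (m ℕ.+ m) ≡ 0 ℕ.+ suc m ℕ.* 2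
    even-form = ℕ-Solver.solve-∀

-- Splitting ∑_{1 ≤ k ≤ 2h} φ(w k) by parity, for the weights w = parityPart b
-- and any φ with φ 0 = 0 (we use φ = id and φ = squaring): only the residues of
-- parity b survive.
∑-evenPart : ∀ h (φ : ℚ → ℚ) → φ 0ℚ ≡ 0ℚ →
  ∑ (h ℕ.+ h) (λ k → φ (parityPart true (suc k))) ≡ ∑ h (λ m → φ (inv (2 ℕ.+ (m ℕ.+ m))))
∑-evenPart h φ φ0≡0 = trans (∑-pairs h (λ k → φ (parityPart true (suc k)))) (∑-cong h keep-even)
  where
    keep-even : ∀ m → m < h →
      φ (parityPart true (suc (m ℕ.+ m))) + φ (parityPart true (2 ℕ.+ (m ℕ.+ m)))
        ≡ φ (inv (2 ℕ.+ (m ℕ.+ m)))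
    keep-even m _ = trans
      (cong₂ (λ u v → φ (if u then inv (suc (m ℕ.+ m)) else 0ℚ)
                     + φ (if v then inv (2 ℕ.+ (m ℕ.+ m)) else 0ℚ))
             (isEven-odd m) (isEven-even m))
      (trans (cong (_+ φ (inv (2 ℕ.+ (m ℕ.+ m)))) φ0≡0) (ℚ.+-identityˡ _))

∑-oddPart : ∀ h (φ : ℚ → ℚ) → φ 0ℚ ≡ 0ℚ →
  ∑ (h ℕ.+ h) (λ k → φ (parityPart false (suc k))) ≡ ∑ h (λ m → φ (inv (suc (m ℕ.+ m))))
∑-oddPart h φ φ0≡0 = trans (∑-pairs h (λ k → φ (parityPart false (suc k)))) (∑-cong h keep-odd)
  where
    odd : Bool → Bool
    odd e = if e then false else true
    keep-odd : ∀ m → m < h →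
      φ (parityPart false (suc (m ℕ.+ m))) + φ (parityPart false (2 ℕ.+ (m ℕ.+ m)))
        ≡ φ (inv (suc (m ℕ.+ m)))
    keep-odd m _ = trans
      (cong₂ (λ u v → φ (if odd u then inv (suc (m ℕ.+ m)) else 0ℚ)
                     + φ (if odd v then inv (2 ℕ.+ (m ℕ.+ m)) else 0ℚ))
             (isEven-odd m) (isEven-even m))
      (trans (cong (λ t → φ (inv (suc (m ℕ.+ m))) + t) φ0≡0) (ℚ.+-identityʳ _))

-- Congruences modulo a prime p between rationals, realised inside ℚ through the
-- ring ℤ₍ₚ₎ of p-integral rationals and its ideal p ℤ₍ₚ₎.
module Congruence (p : ℕ) (p-prime : Prime p) where

  p∤-* : ∀ {m n} → ¬ p ∣ m → ¬ p ∣ n → ¬ p ∣ (m ℕ.* n)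
  p∤-* {m} {n} p∤m p∤n p∣mn = [ p∤m , p∤n ]′ (euclidsLemma m n p-prime p∣mn)

  p∤-small : ∀ {k} → 0 < k → k < p → ¬ p ∣ k
  p∤-small {suc k} _ k<p p∣k = ℕ.<⇒≱ k<p (∣⇒≤ p∣k)

  p∤1 : ¬ p ∣ 1
  p∤1 p∣1 = nonTrivial⇒≢1 {{prime⇒nonTrivial p-prime}} (∣1⇒≡1 p∣1)

  record Integral (x : ℚ) : Set where
    constructor integral
    field
      den    : ℕ
      p∤den  : ¬ p ∣ den
      num    : ℤ
      clears : x * fromℕ den ≡ fromℤ num

  record Multiple (x : ℚ) : Set where
    constructor multiple
    field
      cofactor          : ℚ
      cofactor-integral : Integral cofactor
      factors           : x ≡ fromℕ p * cofactor

  integral-fromℤ : ∀ a → Integral (fromℤ a)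
  integral-fromℤ a = integral 1 p∤1 a (trans (sym (fromℤ-* a (+ 1))) (cong fromℤ (ℤ.*-identityʳ a)))

  integral-inv : ∀ k → ¬ p ∣ k → Integral (inv k)
  integral-inv zero    p∤0 = ⊥-elim (p∤0 (p ∣0))
  integral-inv (suc k) p∤k = integral (suc k) p∤k (+ 1) (inv-cancel k)

  integral-inv-small : ∀ k → suc k < p → Integral (inv (suc k))
  integral-inv-small k k<p = integral-inv (suc k) (p∤-small (s≤s z≤n) k<p)

  integral-inv-part : ∀ a c → suc a ℕ.+ suc c ≡ p → Integral (inv (suc a))
  integral-inv-part a c a+c≡p =
    integral-inv-small a (subst (suc a <_) a+c≡p (ℕ.m<m+n (suc a) (s≤s z≤n)))

  integral-+ : ∀ {x y} → Integral x → Integral y → Integral (x + y)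
  integral-+ {x} {y} (integral b p∤b a xb≡a) (integral d p∤d c yd≡c) =
    integral (b ℕ.* d) (p∤-* p∤b p∤d) (a ℤ.* + d ℤ.+ c ℤ.* + b) (begin
      (x + y) * fromℕ (b ℕ.* d)                   ≡⟨ cong ((x + y) *_) (fromℕ-* b d) ⟩
      (x + y) * (fromℕ b * fromℕ d)               ≡⟨ distribute x y (fromℕ b) (fromℕ d) ⟩
      (x * fromℕ b) * fromℕ d + (y * fromℕ d) * fromℕ b
        ≡⟨ cong₂ (λ u v → u * fromℕ d + v * fromℕ b) xb≡a yd≡c ⟩
      fromℤ a * fromℕ d + fromℤ c * fromℕ b
        ≡⟨ cong₂ _+_ (fromℤ-* a (+ d)) (fromℤ-* c (+ b)) ⟨
      fromℤ (a ℤ.* + d) + fromℤ (c ℤ.* + b)       ≡⟨ fromℤ-+ (a ℤ.* + d) (c ℤ.* + b) ⟨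
      fromℤ (a ℤ.* + d ℤ.+ c ℤ.* + b)             ∎)
    where
      open ≡-Reasoning
      distribute : ∀ x y b d → (x + y) * (b * d) ≡ (x * b) * d + (y * d) * b
      distribute = solve-∀ ℚ-ring

  integral-* : ∀ {x y} → Integral x → Integral y → Integral (x * y)
  integral-* {x} {y} (integral b p∤b a xb≡a) (integral d p∤d c yd≡c) =
    integral (b ℕ.* d) (p∤-* p∤b p∤d) (a ℤ.* c) (begin
      (x * y) * fromℕ (b ℕ.* d)          ≡⟨ cong ((x * y) *_) (fromℕ-* b d) ⟩
      (x * y) * (fromℕ b * fromℕ d)      ≡⟨ interchange x y (fromℕ b) (fromℕ d) ⟩
      (x * fromℕ b) * (y * fromℕ d)      ≡⟨ cong₂ _*_ xb≡a yd≡c ⟩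
      fromℤ a * fromℤ c                  ≡⟨ fromℤ-* a c ⟨
      fromℤ (a ℤ.* c)                    ∎)
    where
      open ≡-Reasoning
      interchange : ∀ x y b d → (x * y) * (b * d) ≡ (x * b) * (y * d)
      interchange = solve-∀ ℚ-ring

  integral-neg : ∀ {x} → Integral x → Integral (- x)
  integral-neg {x} (integral b p∤b a xb≡a) = integral b p∤b (ℤ.- a) (begin
    (- x) * fromℕ b   ≡⟨ ℚ.neg-distribˡ-* x (fromℕ b) ⟨
    - (x * fromℕ b)   ≡⟨ cong -_ xb≡a ⟩
    - fromℤ a         ≡⟨ fromℤ-neg a ⟨
    fromℤ (ℤ.- a)     ∎)
    where open ≡-Reasoning

  integral-∑ : ∀ n f → (∀ k → k < n → Integral (f k)) → Integral (∑ n f)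
  integral-∑ zero    f _          = integral-fromℤ (+ 0)
  integral-∑ (suc n) f f-integral = integral-+ (f-integral 0 (s≤s z≤n))
    (integral-∑ n (λ k → f (suc k)) (λ k k<n → f-integral (suc k) (s≤s k<n)))

  multiple-+ : ∀ {x y} → Multiple x → Multiple y → Multiple (x + y)
  multiple-+ {x} {y} (multiple u u-int x≡pu) (multiple v v-int y≡pv) =
    multiple (u + v) (integral-+ u-int v-int)
      (trans (cong₂ _+_ x≡pu y≡pv) (sym (ℚ.*-distribˡ-+ (fromℕ p) u v)))

  multiple-* : ∀ {x z} → Multiple x → Integral z → Multiple (x * z)
  multiple-* {x} {z} (multiple u u-int x≡pu) z-int =
    multiple (u * z) (integral-* u-int z-int)
      (trans (cong (_* z) x≡pu) (ℚ.*-assoc (fromℕ p) u z))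

  multiple-neg : ∀ {x} → Multiple x → Multiple (- x)
  multiple-neg {x} (multiple u u-int x≡pu) =
    multiple (- u) (integral-neg u-int)
      (trans (cong -_ x≡pu) (ℚ.neg-distribʳ-* (fromℕ p) u))

  multiple-p : ∀ {y} → Integral y → Multiple (fromℕ p * y)
  multiple-p {y} y-int = multiple y y-int refl

  multiple-cong : ∀ {x y} → x ≡ y → Multiple x → Multiple y
  multiple-cong refl x-mult = x-mult

  -- An integer in p ℤ₍ₚ₎ is divisible by p (Euclid's lemma clears the denominator).
  multiple⇒divisible : ∀ a → Multiple (fromℤ a) → (+ p) ∣ℤ a
  multiple⇒divisible a (multiple y (integral d p∤d c yd≡c) a≡py) =
    [ (λ p∣a → p∣a) , (λ p∣d → ⊥-elim (p∤d p∣d)) ]′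
      (euclidsLemma ∣ a ∣ d p-prime (divides ∣ c ∣ (begin
        ∣ a ∣ ℕ.* d         ≡⟨ ℤ.abs-* a (+ d) ⟨
        ∣ a ℤ.* + d ∣       ≡⟨ cong ∣_∣ (fromℤ-injective integer-equation) ⟩
        ∣ + p ℤ.* c ∣       ≡⟨ ℤ.abs-* (+ p) c ⟩
        p ℕ.* ∣ c ∣         ≡⟨ ℕ.*-comm p ∣ c ∣ ⟩
        ∣ c ∣ ℕ.* p         ∎)))
    where
      open ≡-Reasoning
      integer-equation : fromℤ (a ℤ.* + d) ≡ fromℤ (+ p ℤ.* c)
      integer-equation = begin
        fromℤ (a ℤ.* + d)          ≡⟨ fromℤ-* a (+ d) ⟩
        fromℤ a * fromℕ d          ≡⟨ cong (_* fromℕ d) a≡py ⟩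
        fromℕ p * y * fromℕ d      ≡⟨ ℚ.*-assoc (fromℕ p) y (fromℕ d) ⟩
        fromℕ p * (y * fromℕ d)    ≡⟨ cong (fromℕ p *_) yd≡c ⟩
        fromℕ p * fromℤ c          ≡⟨ fromℤ-* (+ p) c ⟨
        fromℤ (+ p ℤ.* c)          ∎

  infix 4 _≈_
  record _≈_ (x y : ℚ) : Set where
    constructor ≈-intro
    field difference : Multiple (x - y)

  ≈-reflexive : ∀ {x y} → x ≡ y → x ≈ y
  ≈-reflexive {x} refl =
    ≈-intro (multiple 0ℚ (integral-fromℤ (+ 0)) (trans (ℚ.+-inverseʳ x) (sym (ℚ.*-zeroʳ (fromℕ p)))))

  ≈-sym : ∀ {x y} → x ≈ y → y ≈ x
  ≈-sym {x} {y} (≈-intro d) = ≈-intro (multiple-cong (negate x y) (multiple-neg d))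
    where
      negate : ∀ x y → - (x - y) ≡ y - x
      negate = solve-∀ ℚ-ring

  ≈-trans : ∀ {x y z} → x ≈ y → y ≈ z → x ≈ z
  ≈-trans {x} {y} {z} (≈-intro d) (≈-intro e) =
    ≈-intro (multiple-cong (telescope x y z) (multiple-+ d e))
    where
      telescope : ∀ x y z → (x - y) + (y - z) ≡ x - z
      telescope = solve-∀ ℚ-ring

  ≈-setoid : Setoid 0ℓ 0ℓ
  ≈-setoid = record
    { Carrier       = ℚ
    ; _≈_           = _≈_
    ; isEquivalence = record { refl = ≈-reflexive refl ; sym = ≈-sym ; trans = ≈-trans }
    }

  module ≈-Reasoning = SetoidReasoning ≈-setoid

  ≈-+ : ∀ {x x′ y y′} → x ≈ x′ → y ≈ y′ → x + y ≈ x′ + y′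
  ≈-+ {x} {x′} {y} {y′} (≈-intro d) (≈-intro e) =
    ≈-intro (multiple-cong (regroup x x′ y y′) (multiple-+ d e))
    where
      regroup : ∀ x x′ y y′ → (x - x′) + (y - y′) ≡ (x + y) - (x′ + y′)
      regroup = solve-∀ ℚ-ring

  ≈-+ˡ : ∀ z {x y} → x ≈ y → z + x ≈ z + y
  ≈-+ˡ z = ≈-+ (≈-reflexive {z} refl)

  ≈-+ʳ : ∀ z {x y} → x ≈ y → x + z ≈ y + z
  ≈-+ʳ z x≈y = ≈-+ x≈y (≈-reflexive {z} refl)

  ≈-neg : ∀ {x y} → x ≈ y → - x ≈ - y
  ≈-neg {x} {y} (≈-intro d) = ≈-intro (multiple-cong (negate x y) (multiple-neg d))
    where
      negate : ∀ x y → - (x - y) ≡ (- x) - (- y)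
      negate = solve-∀ ℚ-ring

  ≈-*ʳ : ∀ {x y} z → Integral z → x ≈ y → x * z ≈ y * z
  ≈-*ʳ {x} {y} z z-int (≈-intro d) =
    ≈-intro (multiple-cong (distribute x y z) (multiple-* d z-int))
    where
      distribute : ∀ x y z → (x - y) * z ≡ x * z - y * z
      distribute = solve-∀ ℚ-ring

  ≈-*ˡ : ∀ {x y} z → Integral z → x ≈ y → z * x ≈ z * y
  ≈-*ˡ {x} {y} z z-int (≈-intro d) =
    ≈-intro (multiple-cong (distribute x y z) (multiple-* d z-int))
    where
      distribute : ∀ x y z → (x - y) * z ≡ z * x - z * y
      distribute = solve-∀ ℚ-ring

  ≈-* : ∀ {x x′ y y′} → Integral x′ → Integral y → x ≈ x′ → y ≈ y′ → x * y ≈ x′ * y′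
  ≈-* {y = y} x′-int y-int x≈x′ y≈y′ = ≈-trans (≈-*ʳ y y-int x≈x′) (≈-*ˡ _ x′-int y≈y′)

  multiple⇒≈0 : ∀ {x} → Multiple x → x ≈ 0ℚ
  multiple⇒≈0 {x} x-mult = ≈-intro (multiple-cong (sym (ℚ.+-identityʳ x)) x-mult)

  ∑-≈ : ∀ n {f g} → (∀ k → k < n → f k ≈ g k) → ∑ n f ≈ ∑ n g
  ∑-≈ zero    f≈g = ≈-reflexive refl
  ∑-≈ (suc n) f≈g = ≈-+ (f≈g 0 (s≤s z≤n)) (∑-≈ n (λ k k<n → f≈g (suc k) (s≤s k<n)))

  ≈-cancel : ∀ k {x y} → ¬ p ∣ k → fromℕ k * x ≈ fromℕ k * y → x ≈ y
  ≈-cancel zero    p∤0 _ = ⊥-elim (p∤0 (p ∣0))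
  ≈-cancel (suc k) {x} {y} p∤k (≈-intro d) =
    ≈-intro (multiple-cong (undo (inv (suc k)) (fromℕ (suc k)) x y (inv-cancel k))
                           (multiple-* d (integral-inv (suc k) p∤k)))
    where
      undo : ∀ i m x y → i * m ≡ 1ℚ → (m * x - m * y) * i ≡ x - y
      undo i m x y im≡1 =
        trans (rearrange i m x y) (trans (cong (_* (x - y)) im≡1) (ℚ.*-identityˡ (x - y)))
        where
          rearrange : ∀ i m x y → (m * x - m * y) * i ≡ (i * m) * (x - y)
          rearrange = solve-∀ ℚ-ring

  -- ≈ implies the congruence of the statement: cross-multiplying x − y ∈ p ℤ₍ₚ₎
  -- by the denominators gives an integer multiple of p.
  ≈⇒≡ℚ : ∀ {x y} → x ≈ y → x ≡ℚ y [mod p ]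
  ≈⇒≡ℚ {x} {y} (≈-intro d) =
    multiple⇒divisible N (multiple-cong cross-multiply (multiple-* d (integral-fromℤ (↧ x ℤ.* ↧ y))))
    where
      open ≡-Reasoning
      N : ℤ
      N = (↥ x ℤ.* ↧ y) ℤ.- (↥ y ℤ.* ↧ x)
      expand : ∀ x y a b → (x - y) * (a * b) ≡ (x * a) * b - (y * b) * a
      expand = solve-∀ ℚ-ring
      cross-multiply : (x - y) * fromℤ (↧ x ℤ.* ↧ y) ≡ fromℤ N
      cross-multiply = begin
        (x - y) * fromℤ (↧ x ℤ.* ↧ y)
          ≡⟨ cong ((x - y) *_) (fromℤ-* (↧ x) (↧ y)) ⟩
        (x - y) * (fromℤ (↧ x) * fromℤ (↧ y))
          ≡⟨ expand x y (fromℤ (↧ x)) (fromℤ (↧ y)) ⟩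
        (x * fromℤ (↧ x)) * fromℤ (↧ y) - (y * fromℤ (↧ y)) * fromℤ (↧ x)
          ≡⟨ cong₂ (λ u v → u * fromℤ (↧ y) - v * fromℤ (↧ x))
                   (clear-denominator x) (clear-denominator y) ⟩
        fromℤ (↥ x) * fromℤ (↧ y) - fromℤ (↥ y) * fromℤ (↧ x)
          ≡⟨ cong₂ _-_ (fromℤ-* (↥ x) (↧ y)) (fromℤ-* (↥ y) (↧ x)) ⟨
        fromℤ (↥ x ℤ.* ↧ y) - fromℤ (↥ y ℤ.* ↧ x)
          ≡⟨ cong (λ t → fromℤ (↥ x ℤ.* ↧ y) + t) (fromℤ-neg (↥ y ℤ.* ↧ x)) ⟨
        fromℤ (↥ x ℤ.* ↧ y) + fromℤ (ℤ.- (↥ y ℤ.* ↧ x))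
          ≡⟨ fromℤ-+ (↥ x ℤ.* ↧ y) (ℤ.- (↥ y ℤ.* ↧ x)) ⟨
        fromℤ N ∎

  inv-reflect : ∀ a c → suc a ℕ.+ suc c ≡ p → inv (suc c) ≈ - inv (suc a)
  inv-reflect a c a+c≡p = ≈-intro (multiple-cong (sym difference) (multiple-p
    (integral-* (integral-inv-part a c a+c≡p)
                (integral-inv-part c a (trans (ℕ.+-comm (suc c) (suc a)) a+c≡p)))))
    where
      open ≡-Reasoning
      -- 1/c + 1/a = (a + c) · (1/a) (1/c).
      combine : ∀ i j m n → i * m ≡ 1ℚ → j * n ≡ 1ℚ → j - (- i) ≡ (m + n) * (i * j)
      combine i j m n im≡1 jn≡1 = begin
        j - (- i)                  ≡⟨ unit-coefficients i j ⟩
        1ℚ * j + 1ℚ * i            ≡⟨ cong₂ (λ u v → u * j + v * i) (sym im≡1) (sym jn≡1) ⟩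
        (i * m) * j + (j * n) * i  ≡⟨ factor i j m n ⟩
        (m + n) * (i * j)          ∎
        where
          unit-coefficients : ∀ i j → j - (- i) ≡ 1ℚ * j + 1ℚ * i
          unit-coefficients = solve-∀ ℚ-ring
          factor : ∀ i j m n → (i * m) * j + (j * n) * i ≡ (m + n) * (i * j)
          factor = solve-∀ ℚ-ring
      difference : inv (suc c) - (- inv (suc a)) ≡ fromℕ p * (inv (suc a) * inv (suc c))
      difference = trans
        (combine (inv (suc a)) (inv (suc c)) (fromℕ (suc a)) (fromℕ (suc c)) (inv-cancel a) (inv-cancel c))
        (cong (_* (inv (suc a) * inv (suc c))) (trans (sym (fromℕ-+ (suc a) (suc c))) (cong fromℕ a+c≡p)))

  ≈-square : ∀ {x y} → Integral x → Integral y → x ≈ - y → x * x ≈ y * y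
  ≈-square {x} {y} x-int y-int x≈-y =
    ≈-trans (≈-* (integral-neg y-int) x-int x≈-y x≈-y) (≈-reflexive (neg-square y))
    where
      neg-square : ∀ y → (- y) * (- y) ≡ y * y
      neg-square = solve-∀ ℚ-ring

module OddPrime (h : ℕ) (p-prime : Prime (suc (h ℕ.+ h))) (2≤h : 2 ≤ h) where

  n p : ℕ
  n = h ℕ.+ h
  p = suc n

  open Congruence p p-prime public

  square : ℚ → ℚ
  square x = x * x

  evenHarmonic oddHarmonic evenSquares oddSquares : ℚ
  evenHarmonic = ∑ h (λ m → inv (2 ℕ.+ (m ℕ.+ m)))
  oddHarmonic  = ∑ h (λ m → inv (suc (m ℕ.+ m)))
  evenSquares  = ∑ h (λ m → square (inv (2 ℕ.+ (m ℕ.+ m))))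
  oddSquares   = ∑ h (λ m → square (inv (suc (m ℕ.+ m))))

  -- Reflection k ↦ p − k matches the even residue 2m + 2 with the odd one 2m′ + 1,
  -- where m′ = h − 1 − m.
  mirror : ℕ → ℕ
  mirror m = h ∸ suc m

  mirror<h : ∀ m → m < h → mirror m < h
  mirror<h m m<h = ℕ.∸-monoʳ-< (s≤s z≤n) m<h

  even+odd≡p : ∀ m → m < h → 2 ℕ.+ (m ℕ.+ m) ℕ.+ suc (mirror m ℕ.+ mirror m) ≡ p
  even+odd≡p m m<h = trans (rearrange (mirror m) m) (cong (λ t → suc (t ℕ.+ t)) (ℕ.m∸n+n≡m m<h))
    where
      rearrange : ∀ j m → 2 ℕ.+ (m ℕ.+ m) ℕ.+ suc (j ℕ.+ j) ≡ suc ((j ℕ.+ suc m) ℕ.+ (j ℕ.+ suc m))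
      rearrange = ℕ-Solver.solve-∀

  integral-even : ∀ m → m < h → Integral (inv (2 ℕ.+ (m ℕ.+ m)))
  integral-even m m<h = integral-inv-part (suc (m ℕ.+ m)) _ (even+odd≡p m m<h)

  integral-odd : ∀ m → m < h → Integral (inv (suc (m ℕ.+ m)))
  integral-odd m m<h = integral-inv-small (m ℕ.+ m) (s≤s (ℕ.+-mono-< m<h m<h))

  integral-evenHarmonic : Integral evenHarmonic
  integral-evenHarmonic = integral-∑ h _ integral-even

  integral-oddHarmonic : Integral oddHarmonic
  integral-oddHarmonic = integral-∑ h _ integral-odd

  odd-reflects-even : ∀ m → m < h → inv (suc (mirror m ℕ.+ mirror m)) ≈ - inv (2 ℕ.+ (m ℕ.+ m))
  odd-reflects-even m m<h = inv-reflect (suc (m ℕ.+ m)) (mirror m ℕ.+ mirror m) (even+odd≡p m m<h)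

  oddHarmonic≈-evenHarmonic : oddHarmonic ≈ - evenHarmonic
  oddHarmonic≈-evenHarmonic = begin
    oddHarmonic                                     ≡⟨ ∑-reverse h _ ⟩
    ∑ h (λ m → inv (suc (mirror m ℕ.+ mirror m)))   ≈⟨ ∑-≈ h odd-reflects-even ⟩
    ∑ h (λ m → - inv (2 ℕ.+ (m ℕ.+ m)))             ≡⟨ ∑-neg h _ ⟩
    - evenHarmonic                                  ∎
    where open ≈-Reasoning

  oddSquares≈evenSquares : oddSquares ≈ evenSquares
  oddSquares≈evenSquares = begin
    oddSquares                                                 ≡⟨ ∑-reverse h _ ⟩
    ∑ h (λ m → square (inv (suc (mirror m ℕ.+ mirror m))))     ≈⟨ ∑-≈ h squares ⟩
    evenSquares                                                ∎
    where
      open ≈-Reasoning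
      squares : ∀ m → m < h →
        square (inv (suc (mirror m ℕ.+ mirror m))) ≈ square (inv (2 ℕ.+ (m ℕ.+ m)))
      squares m m<h =
        ≈-square (integral-odd (mirror m) (mirror<h m m<h)) (integral-even m m<h) (odd-reflects-even m m<h)

  halfSquares : ℚ
  halfSquares = ∑ h (λ k → square (inv (suc k)))

  evenSquares-quarter : fromℕ 4 * evenSquares ≡ halfSquares
  evenSquares-quarter = begin
    fromℕ 4 * evenSquares
      ≡⟨ cong (fromℕ 4 *_) (∑-cong h (λ m _ → halve m)) ⟩
    fromℕ 4 * ∑ h (λ k → quarter * square (inv (suc k)))
      ≡⟨ cong (fromℕ 4 *_) (∑-*ˡ h quarter (λ k → square (inv (suc k)))) ⟩
    fromℕ 4 * (quarter * halfSquares)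
      ≡⟨ regroup (fromℕ 2) (inv 2) halfSquares ⟩
    square (inv 2 * fromℕ 2) * halfSquares
      ≡⟨ cong (λ t → square t * halfSquares) (inv-cancel 1) ⟩
    1ℚ * halfSquares
      ≡⟨ ℚ.*-identityˡ halfSquares ⟩
    halfSquares ∎
    where
      open ≡-Reasoning
      quarter : ℚ
      quarter = inv 2 * inv 2
      double : ∀ m → 2 ℕ.+ (m ℕ.+ m) ≡ 2 ℕ.* suc m
      double = ℕ-Solver.solve-∀
      square-product : ∀ a b → (a * b) * (a * b) ≡ (a * a) * (b * b)
      square-product = solve-∀ ℚ-ring
      halve : ∀ m → square (inv (2 ℕ.+ (m ℕ.+ m))) ≡ quarter * square (inv (suc m))
      halve m = trans (cong (λ t → square (inv t)) (double m))
                      (trans (cong square (inv-* 1 m)) (square-product (inv 2) (inv (suc m))))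
      regroup : ∀ t i s → (t * t) * ((i * i) * s) ≡ ((i * t) * (i * t)) * s
      regroup = solve-∀ ℚ-ring

  allSquares : ℚ
  allSquares = ∑ n (λ k → square (inv (suc k)))

  allSquares-by-parity : allSquares ≡ oddSquares + evenSquares
  allSquares-by-parity = trans (∑-pairs h (λ k → square (inv (suc k)))) (∑-+ h _ _)

  allSquares≈twice-half : allSquares ≈ halfSquares + halfSquares
  allSquares≈twice-half = begin
    allSquares
      ≡⟨ ∑-split h h (λ k → square (inv (suc k))) ⟩
    halfSquares + ∑ h (λ k → square (inv (suc (h ℕ.+ k))))
      ≡⟨ cong (λ t → halfSquares + t) (∑-reverse h (λ k → square (inv (suc (h ℕ.+ k))))) ⟩
    halfSquares + ∑ h (λ k → square (inv (suc (h ℕ.+ mirror k))))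
      ≈⟨ ≈-+ˡ halfSquares (∑-≈ h reflected) ⟩
    halfSquares + halfSquares ∎
    where
      open ≈-Reasoning
      sum≡p : ∀ k → k < h → suc k ℕ.+ suc (h ℕ.+ mirror k) ≡ p
      sum≡p k k<h = trans (rearrange h (mirror k) k) (cong (λ t → suc (h ℕ.+ t)) (ℕ.m∸n+n≡m k<h))
        where
          rearrange : ∀ h j k → suc k ℕ.+ suc (h ℕ.+ j) ≡ suc (h ℕ.+ (j ℕ.+ suc k))
          rearrange = ℕ-Solver.solve-∀
      reflected : ∀ k → k < h → square (inv (suc (h ℕ.+ mirror k))) ≈ square (inv (suc k))
      reflected k k<h = ≈-square
        (integral-inv-part _ k (trans (ℕ.+-comm (suc (h ℕ.+ mirror k)) (suc k)) (sum≡p k k<h)))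
        (integral-inv-part k _ (sum≡p k k<h))
        (inv-reflect k (h ℕ.+ mirror k) (sum≡p k k<h))

  5≤p : 5 ≤ p
  5≤p = s≤s (ℕ.+-mono-≤ 2≤h 2≤h)

  p∤2 : ¬ p ∣ 2
  p∤2 = p∤-small (s≤s z≤n) (ℕ.≤-trans (s≤s (s≤s (s≤s z≤n))) 5≤p)

  p∤6 : ¬ p ∣ 6
  p∤6 = p∤-* {2} {3} p∤2 (p∤-small (s≤s z≤n) (ℕ.≤-trans (s≤s (s≤s (s≤s (s≤s z≤n)))) 5≤p))

  -- ∑_{k even} 1/k² ≡ 0 (mod p): twice it is ≡ 2·halfSquares = 8 times it, and 6 is a unit.
  evenSquares≈0 : evenSquares ≈ 0ℚ
  evenSquares≈0 = ≈-cancel 6 p∤6 (begin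
    fromℕ 6 * E
      ≡⟨ six-times E ⟩
    (fromℕ 4 * E + fromℕ 4 * E) - (E + E)
      ≡⟨ cong (λ c → (c + c) - (E + E)) evenSquares-quarter ⟩
    (halfSquares + halfSquares) - (E + E)
      ≈⟨ ≈-+ʳ (- (E + E)) twice-half≈twice-even ⟩
    (E + E) - (E + E)
      ≡⟨ ℚ.+-inverseʳ (E + E) ⟩
    0ℚ
      ≡⟨ ℚ.*-zeroʳ (fromℕ 6) ⟨
    fromℕ 6 * 0ℚ ∎)
    where
      open ≈-Reasoning
      E : ℚ
      E = evenSquares
      six-times : ∀ e → fromℕ 6 * e ≡ (fromℕ 4 * e + fromℕ 4 * e) - (e + e)
      six-times = solve-∀ ℚ-ring
      twice-half≈twice-even : halfSquares + halfSquares ≈ E + E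
      twice-half≈twice-even = begin
        halfSquares + halfSquares   ≈⟨ allSquares≈twice-half ⟨
        allSquares                  ≡⟨ allSquares-by-parity ⟩
        oddSquares + E              ≈⟨ ≈-+ʳ E oddSquares≈evenSquares ⟩
        E + E                       ∎

  -- The binomial quotient  X = ∑_{k<n} C(n, k)/(k+1),  so that 2^p = 2 + p·X.
  binomialQuotient : ℚ
  binomialQuotient = ∑ n (λ k → fromℕ (n C k) * inv (suc k))

  integral-binomialQuotient : Integral binomialQuotient
  integral-binomialQuotient = integral-∑ n _ (λ k k<n →
    integral-* (integral-fromℤ (+ (n C k))) (integral-inv-small k (s≤s k<n)))

  mersenne : ℕ
  mersenne = 2 ^ n ∸ 1

  two-mersenne : fromℕ 2 * fromℕ mersenne ≡ fromℕ p * binomialQuotient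
  two-mersenne = +-cancelʳ (begin
    fromℕ 2 * fromℕ mersenne + fromℕ 2   ≡⟨ cong (_+ fromℕ 2) (fromℕ-* 2 mersenne) ⟨
    fromℕ (2 ℕ.* mersenne) + fromℕ 2     ≡⟨ fromℕ-+ (2 ℕ.* mersenne) 2 ⟨
    fromℕ (2 ℕ.* mersenne ℕ.+ 2)         ≡⟨ cong fromℕ power-of-two ⟨
    fromℕ (2 ^ p)                        ≡⟨ power-of-two-expansion n ⟩
    1ℚ + (fromℕ p * binomialQuotient + 1ℚ) ≡⟨ regroup (fromℕ p * binomialQuotient) ⟩
    fromℕ p * binomialQuotient + fromℕ 2 ∎)
    where
      open ≡-Reasoning
      2^n≡1+M : 2 ^ n ≡ suc mersenne
      2^n≡1+M = sym (trans (ℕ.+-comm 1 mersenne) (ℕ.m∸n+n≡m (ℕ.m^n>0 2 n)))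
      power-of-two : 2 ^ p ≡ 2 ℕ.* mersenne ℕ.+ 2
      power-of-two = trans (cong (2 ℕ.*_) 2^n≡1+M) (expand mersenne)
        where
          expand : ∀ m → 2 ℕ.* suc m ≡ 2 ℕ.* m ℕ.+ 2
          expand = ℕ-Solver.solve-∀
      regroup : ∀ y → 1ℚ + (y + 1ℚ) ≡ y + (1ℚ + 1ℚ)
      regroup = solve-∀ ℚ-ring
      +-cancelʳ : ∀ {a b c} → a + c ≡ b + c → a ≡ b
      +-cancelʳ {a} {b} {c} a+c≡b+c =
        trans (uncancel a c) (trans (cong (_- c) a+c≡b+c) (sym (uncancel b c)))
        where
          uncancel : ∀ a c → a ≡ (a + c) - c
          uncancel = solve-∀ ℚ-ring

  -- Fermat's little theorem for base 2: p ∣ M, because M = p · (X/2) with X/2 p-integral.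
  p∣mersenne : p ∣ mersenne
  p∣mersenne = multiple⇒divisible (+ mersenne)
    (multiple-cong (sym halve) (multiple-p (integral-* integral-binomialQuotient (integral-inv 2 p∤2))))
    where
      open ≡-Reasoning
      halve : fromℕ mersenne ≡ fromℕ p * (binomialQuotient * inv 2)
      halve = begin
        fromℕ mersenne                             ≡⟨ ℚ.*-identityˡ _ ⟨
        1ℚ * fromℕ mersenne                        ≡⟨ cong (_* fromℕ mersenne) (inv-cancel 1) ⟨
        (inv 2 * fromℕ 2) * fromℕ mersenne         ≡⟨ ℚ.*-assoc (inv 2) (fromℕ 2) (fromℕ mersenne) ⟩
        inv 2 * (fromℕ 2 * fromℕ mersenne)         ≡⟨ cong (inv 2 *_) two-mersenne ⟩
        inv 2 * (fromℕ p * binomialQuotient)       ≡⟨ rotate (inv 2) (fromℕ p) binomialQuotient ⟩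
        fromℕ p * (binomialQuotient * inv 2)       ∎
        where
          rotate : ∀ i a x → i * (a * x) ≡ a * (x * i)
          rotate = solve-∀ ℚ-ring

  q : ℕ
  q = fermatQuotient2 p

  two-q : fromℕ 2 * fromℕ q ≡ binomialQuotient
  two-q = fromℕ-cancelˡ n (begin
    fromℕ p * (fromℕ 2 * fromℕ q)    ≡⟨ swap (fromℕ p) (fromℕ 2) (fromℕ q) ⟩
    fromℕ 2 * (fromℕ q * fromℕ p)    ≡⟨ cong (fromℕ 2 *_) (fromℕ-* q p) ⟨
    fromℕ 2 * fromℕ (q ℕ.* p)        ≡⟨ cong (λ t → fromℕ 2 * fromℕ t) (m/n*n≡m p∣mersenne) ⟩
    fromℕ 2 * fromℕ mersenne         ≡⟨ two-mersenne ⟩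
    fromℕ p * binomialQuotient       ∎)
    where
      open ≡-Reasoning
      swap : ∀ a b c → a * (b * c) ≡ b * (c * a)
      swap = solve-∀ ℚ-ring

  sign : ℕ → ℚ
  sign zero    = 1ℚ
  sign (suc k) = - sign k

  sign-even : ∀ m → sign (m ℕ.+ m) ≡ 1ℚ
  sign-even zero    = refl
  sign-even (suc m) = trans (cong sign (cong suc (ℕ.+-suc m m)))
                            (trans (double-negation (sign (m ℕ.+ m))) (sign-even m))
    where
      double-negation : ∀ x → - (- x) ≡ x
      double-negation = solve-∀ ℚ-ring

  -- C(p − 1, k) ≡ (−1)^k (mod p): by Pascal's rule C(n, k+1) = C(p, k+1) − C(n, k),
  -- and C(p, k+1) = p·C(n, k)/(k+1) is a multiple of p.
  binomial-alternates : ∀ k → k ≤ n → fromℕ (n C k) ≈ sign k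
  binomial-alternates zero    _     = ≈-reflexive refl
  binomial-alternates (suc k) 1+k≤n = begin
    fromℕ (n C suc k)                            ≡⟨ pascal ⟩
    fromℕ (p C suc k) + - fromℕ (n C k)          ≈⟨ ≈-+ p-multiple (≈-neg induction-hypothesis) ⟩
    0ℚ + - sign k                                ≡⟨ ℚ.+-identityˡ (- sign k) ⟩
    - sign k                                     ∎
    where
      open ≈-Reasoning
      induction-hypothesis : fromℕ (n C k) ≈ sign k
      induction-hypothesis = binomial-alternates k (ℕ.<⇒≤ 1+k≤n)
      pascal : fromℕ (n C suc k) ≡ fromℕ (p C suc k) + - fromℕ (n C k)
      pascal = trans (cancel-left (fromℕ (n C k)) (fromℕ (n C suc k)))
        (cong (λ t → t + - fromℕ (n C k))
              (trans (sym (fromℕ-+ (n C k) (n C suc k)))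
                     (cong fromℕ (nCk+nC[k+1]≡[n+1]C[k+1] n k))))
        where
          cancel-left : ∀ x y → y ≡ (x + y) + - x
          cancel-left = solve-∀ ℚ-ring
      p-multiple : fromℕ (p C suc k) ≈ 0ℚ
      p-multiple = multiple⇒≈0 (multiple-cong (sym (binomial-absorbed n k))
        (multiple-p (integral-* (integral-fromℤ (+ (n C k))) (integral-inv-small k (s≤s 1+k≤n)))))

  binomialQuotient≈ : binomialQuotient ≈ oddHarmonic - evenHarmonic
  binomialQuotient≈ = begin
    binomialQuotient
      ≈⟨ ∑-≈ n (λ k k<n → ≈-*ʳ (inv (suc k)) (integral-inv-small k (s≤s k<n))
                                  (binomial-alternates k (ℕ.<⇒≤ k<n))) ⟩
    ∑ n (λ k → sign k * inv (suc k))
      ≡⟨ ∑-pairs h (λ k → sign k * inv (suc k)) ⟩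
    ∑ h (λ m → sign (m ℕ.+ m) * inv (suc (m ℕ.+ m)) + - sign (m ℕ.+ m) * inv (2 ℕ.+ (m ℕ.+ m)))
      ≡⟨ ∑-cong h (λ m _ → signs m) ⟩
    ∑ h (λ m → inv (suc (m ℕ.+ m)) + - inv (2 ℕ.+ (m ℕ.+ m)))
      ≡⟨ ∑-+ h _ _ ⟩
    oddHarmonic + ∑ h (λ m → - inv (2 ℕ.+ (m ℕ.+ m)))
      ≡⟨ cong (λ t → oddHarmonic + t) (∑-neg h _) ⟩
    oddHarmonic - evenHarmonic ∎
    where
      open ≈-Reasoning
      unit-signs : ∀ x y → 1ℚ * x + - 1ℚ * y ≡ x + - y
      unit-signs = solve-∀ ℚ-ring
      signs : ∀ m → sign (m ℕ.+ m) * inv (suc (m ℕ.+ m)) + - sign (m ℕ.+ m) * inv (2 ℕ.+ (m ℕ.+ m))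
                    ≡ inv (suc (m ℕ.+ m)) + - inv (2 ℕ.+ (m ℕ.+ m))
      signs m = trans (cong (λ s → s * inv (suc (m ℕ.+ m)) + - s * inv (2 ℕ.+ (m ℕ.+ m))) (sign-even m))
                      (unit-signs (inv (suc (m ℕ.+ m))) (inv (2 ℕ.+ (m ℕ.+ m))))

  -- q_p(2) ≡ −∑_{k even} 1/k (mod p):  2q = X ≡ O − A ≡ −2A, and 2 is a unit.
  q≈-evenHarmonic : fromℕ q ≈ - evenHarmonic
  q≈-evenHarmonic = ≈-cancel 2 p∤2 (begin
    fromℕ 2 * fromℕ q                     ≡⟨ two-q ⟩
    binomialQuotient                      ≈⟨ binomialQuotient≈ ⟩
    oddHarmonic - evenHarmonic            ≈⟨ ≈-+ʳ (- evenHarmonic) oddHarmonic≈-evenHarmonic ⟩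
    - evenHarmonic - evenHarmonic         ≡⟨ double (- evenHarmonic) ⟩
    fromℕ 2 * (- evenHarmonic)            ∎)
    where
      open ≈-Reasoning
      double : ∀ x → x + x ≡ fromℕ 2 * x
      double = solve-∀ ℚ-ring

  twice-evenPairs : fromℕ 2 * pairSum true p ≡ evenHarmonic * evenHarmonic - evenSquares
  twice-evenPairs = trans (cong (fromℕ 2 *_) (pairSum-as-pairProducts true n))
    (trans (square-of-sum n (λ k → parityPart true (suc k)))
           (cong₂ (λ s t → s * s - t) (∑-evenPart h (λ x → x) refl) (∑-evenPart h square refl)))

  twice-oddPairs : fromℕ 2 * pairSum false p ≡ oddHarmonic * oddHarmonic - oddSquares
  twice-oddPairs = trans (cong (fromℕ 2 *_) (pairSum-as-pairProducts false n))
    (trans (square-of-sum n (λ k → parityPart false (suc k)))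
           (cong₂ (λ s t → s * s - t) (∑-oddPart h (λ x → x) refl) (∑-oddPart h square refl)))

  q²≈twice-evenPairs : fromℕ (q ^ 2) ≈ fromℕ 2 * pairSum true p
  q²≈twice-evenPairs = begin
    fromℕ (q ^ 2)                                 ≡⟨ cong fromℕ (cong (q ℕ.*_) (ℕ.*-identityʳ q)) ⟩
    fromℕ (q ℕ.* q)                               ≡⟨ fromℕ-* q q ⟩
    fromℕ q * fromℕ q
      ≈⟨ ≈-square (integral-fromℤ (+ q)) integral-evenHarmonic q≈-evenHarmonic ⟩
    evenHarmonic * evenHarmonic                   ≡⟨ ℚ.+-identityʳ _ ⟨
    evenHarmonic * evenHarmonic + 0ℚ
      ≈⟨ ≈-+ˡ (evenHarmonic * evenHarmonic) (≈-neg (≈-sym evenSquares≈0)) ⟩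
    evenHarmonic * evenHarmonic - evenSquares     ≡⟨ twice-evenPairs ⟨
    fromℕ 2 * pairSum true p                      ∎
    where open ≈-Reasoning

  twice-evenPairs≈twice-oddPairs : fromℕ 2 * pairSum true p ≈ fromℕ 2 * pairSum false p
  twice-evenPairs≈twice-oddPairs = begin
    fromℕ 2 * pairSum true p                      ≡⟨ twice-evenPairs ⟩
    evenHarmonic * evenHarmonic - evenSquares     ≈⟨ ≈-+ harmonic-squares (≈-neg oddSquares≈evenSquares) ⟨
    oddHarmonic * oddHarmonic - oddSquares        ≡⟨ twice-oddPairs ⟨
    fromℕ 2 * pairSum false p                     ∎
    where
      open ≈-Reasoning
      harmonic-squares : oddHarmonic * oddHarmonic ≈ evenHarmonic * evenHarmonic
      harmonic-squares =
        ≈-square integral-oddHarmonic integral-evenHarmonic oddHarmonic≈-evenHarmonic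

even-or-odd : ∀ m → ∃[ h ] (m ≡ h ℕ.+ h ⊎ m ≡ suc (h ℕ.+ h))
even-or-odd zero    = 0 , inj₁ refl
even-or-odd (suc m) with even-or-odd m
... | h , inj₁ m≡2h   = h , inj₂ (cong suc m≡2h)
... | h , inj₂ m≡2h+1 = suc h , inj₁ (cong suc (trans m≡2h+1 (sym (ℕ.+-suc h h))))

prime≥5-odd : ∀ p → Prime p → 5 ≤ p → ∃[ h ] (p ≡ suc (h ℕ.+ h) × 2 ≤ h)
prime≥5-odd p p-prime 5≤p with even-or-odd p
... | h , inj₂ p≡2h+1 = h , p≡2h+1 , half-bound h (subst (5 ≤_) p≡2h+1 5≤p)
  where
    half-bound : ∀ h → 5 ≤ suc (h ℕ.+ h) → 2 ≤ h
    half-bound zero          (s≤s ())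
    half-bound (suc zero)    (s≤s (s≤s (s≤s ())))
    half-bound (suc (suc h)) _ = s≤s (s≤s z≤n)
... | h , inj₁ p≡2h = ⊥-elim (prime⇒¬composite p-prime
      (composite {2} (ℕ.≤-trans (s≤s (s≤s (s≤s z≤n))) 5≤p)
                     (divides h (trans p≡2h (double≡*2 h)))))
  where
    double≡*2 : ∀ h → h ℕ.+ h ≡ h ℕ.* 2
    double≡*2 = ℕ-Solver.solve-∀

lemma2p5 : (p : ℕ) → Prime p → 5 ≤ p →
    ((((+ (fermatQuotient2 p ^ 2)) / 1) ≡ℚ (((+ 2) / 1) * pairSum true p) [mod p ])
    × ((((+ 2) / 1) * pairSum true p) ≡ℚ (((+ 2) / 1) * pairSum false p) [mod p ]))
lemma2p5 p p-prime 5≤p with prime≥5-odd p p-prime 5≤p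
... | h , refl , 2≤h =
  numerals (/1≡fromℕ (q ^ 2)) (two (pairSum true p)) (≈⇒≡ℚ q²≈twice-evenPairs) ,
  numerals (two (pairSum true p)) (two (pairSum false p)) (≈⇒≡ℚ twice-evenPairs≈twice-oddPairs)
  where
    open OddPrime h p-prime 2≤h hiding (p)
    numerals : ∀ {x x′ y y′} → x′ ≡ x → y′ ≡ y → x ≡ℚ y [mod p ] → x′ ≡ℚ y′ [mod p ]
    numerals refl refl x≡y = x≡y
    two : ∀ s → ((+ 2) / 1) * s ≡ fromℕ 2 * s
    two s = cong (_* s) (/1≡fromℕ 2)
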